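{- For all integers $0 \le i \le m$ and every real (or complex) $x$, \[ \sum_{j=0}^{m-i} \binom{i+j}{i} \genfrac{[}{]}{0pt}{}{m+1}{i+j+1} x^j = \sum_{j=0}^{m-i} \binom{i+j}{i} \genfrac{[}{]}{0pt}{}{m}{i+j} (x+1)^j . \]
   Context: $\genfrac{[}{]}{0pt}{}{a}{b}$ denotes the unsigned Stirling number of the first kind (number of permutations of $\{1,\dots,a\}$ with exactly $b$ cycles), with $\genfrac{[}{]}{0pt}{}{0}{0}=1$. -}

module Defs where

open import Level using (Level)
open import Data.Nat using (ℕ; zero; suc)
import Data.Nat as ℕ
open import Algebra.Bundles using (CommutativeRing)

stirling1 : ℕ → ℕ → ℕ
stirling1 zero    zero    = 1
stirling1 zero    (suc k) = 0
stirling1 (suc n) zero    = 0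
stirling1 (suc n) (suc k) = n ℕ.* stirling1 n (suc k) ℕ.+ stirling1 n k

module RingDefs {c ℓ : Level} (R : CommutativeRing c ℓ) where
  open CommutativeRing R

  fromℕ : ℕ → Carrier
  fromℕ zero    = 0#
  fromℕ (suc n) = 1# + fromℕ n

  pow : Carrier → ℕ → Carrier
  pow x zero    = 1#
  pow x (suc n) = x * pow x n

  sumBelow : ℕ → (ℕ → Carrier) → Carrier
  sumBelow zero    f = 0#
  sumBelow (suc n) f = sumBelow n f + f n

{-# OPTIONS --safe #-}
-- Let Qₘ(t) = Σₖ [m k] tᵏ = t(t+1)⋯(t+m-1) and Pₘ(t) = Σₖ [m+1 k+1] tᵏ = (t+1)⋯(t+m) = Qₘ(t+1).
-- The two sides are the i-th Hasse derivatives D⁽ⁱ⁾p = Σⱼ C(i+j,i) pᵢ₊ⱼ tʲ of Pₘ at x and of Qₘ at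
-- x + 1, which agree because differentiation commutes with translation.  On coefficient sequences
-- this becomes an induction on m, using Pₘ₊₁ = (m+1)Pₘ + t Pₘ, Qₘ₊₁ = m Qₘ + t Qₘ and the Leibniz
-- rule D⁽ⁱ⁾(t p) = t D⁽ⁱ⁾p + D⁽ⁱ⁻¹⁾p.
module Submission where

open import Defs
open import Level using (Level)
open import Data.Nat using (ℕ; suc; _+_; _∸_; _≤_)
open import Data.Nat.Combinatorics using (_C_)
open import Algebra.Bundles using (CommutativeRing)
open import Data.Nat using (zero; _*_; _<_; s≤s; s<s⁻¹)
import Data.Nat.Properties as ℕ
open import Data.Nat.Combinatorics using (k>n⇒nCk≡0; nCk+nC[k+1]≡[n+1]C[k+1])
open import Relation.Binary.PropositionalEquality as ≡ using (_≡_; _≗_)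

-- If a is the coefficient sequence of p(t), then shiftʳ a is that of t · p(t).
shiftʳ : (ℕ → ℕ) → ℕ → ℕ
shiftʳ a zero    = 0
shiftʳ a (suc k) = a k

stirling1-vanishes : ∀ {n k} → n < k → stirling1 n k ≡ 0
stirling1-vanishes {zero}  {suc k} _ = ≡.refl
stirling1-vanishes {suc n} {suc k} (s≤s n<k)
  rewrite stirling1-vanishes (ℕ.m<n⇒m<1+n n<k) | stirling1-vanishes n<k | ℕ.*-zeroʳ n = ≡.refl

stirling1-suc : ∀ n → stirling1 (suc n) ≗ λ k → n * stirling1 n k + shiftʳ (stirling1 n) k
stirling1-suc zero    zero    = ≡.refl
stirling1-suc (suc n) zero    = ≡.cong (_+ 0) (≡.sym (ℕ.*-zeroʳ n))
stirling1-suc n       (suc k) = ≡.refl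

stirling1-suc-suc : ∀ n → (λ k → stirling1 (suc (suc n)) (suc k))
  ≗ λ k → suc n * stirling1 (suc n) (suc k) + shiftʳ (λ k → stirling1 (suc n) (suc k)) k
stirling1-suc-suc n zero    = ≡.refl
stirling1-suc-suc n (suc k) = ≡.refl

module _ {c ℓ : Level} (R : CommutativeRing c ℓ) where
  open CommutativeRing R renaming (_+_ to _+R_; _*_ to _*R_)
  open RingDefs R
  open import Relation.Binary.Reasoning.Setoid setoid
  open import Algebra.Solver.Ring.NaturalCoefficients.Default commutativeSemiring
  open import Algebra.Properties.Semiring.Mult semiring using (_×_; ×-homo-+; ×1-homo-*)
  open import Algebra.Properties.CommutativeSemigroup +-commutativeSemigroup
    using () renaming (interchange to +-interchange)
  open import Algebra.Properties.CommutativeSemigroup *-commutativeSemigroup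
    using () renaming (x∙yz≈y∙xz to *-leftComm)

  fromℕ≈×1# : ∀ n → fromℕ n ≈ n × 1#
  fromℕ≈×1# zero    = refl
  fromℕ≈×1# (suc n) = +-cong refl (fromℕ≈×1# n)

  fromℕ-+ : ∀ m n → fromℕ (m + n) ≈ fromℕ m +R fromℕ n
  fromℕ-+ m n = begin
    fromℕ (m + n)           ≈⟨ fromℕ≈×1# (m + n) ⟩
    (m + n) × 1#            ≈⟨ ×-homo-+ 1# m n ⟩
    m × 1# +R n × 1#        ≈⟨ +-cong (fromℕ≈×1# m) (fromℕ≈×1# n) ⟨
    fromℕ m +R fromℕ n      ∎

  fromℕ-* : ∀ m n → fromℕ (m * n) ≈ fromℕ m *R fromℕ n
  fromℕ-* m n = begin
    fromℕ (m * n)           ≈⟨ fromℕ≈×1# (m * n) ⟩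
    (m * n) × 1#            ≈⟨ ×1-homo-* m n ⟩
    (m × 1#) *R (n × 1#)    ≈⟨ *-cong (fromℕ≈×1# m) (fromℕ≈×1# n) ⟨
    fromℕ m *R fromℕ n      ∎

  sumBelow-cong : ∀ N {f g : ℕ → Carrier} → (∀ j → f j ≈ g j) → sumBelow N f ≈ sumBelow N g
  sumBelow-cong zero    f≈g = refl
  sumBelow-cong (suc N) f≈g = +-cong (sumBelow-cong N f≈g) (f≈g N)

  sumBelow-+ : ∀ N f g → sumBelow N (λ j → f j +R g j) ≈ sumBelow N f +R sumBelow N g
  sumBelow-+ zero    f g = sym (+-identityˡ 0#)
  sumBelow-+ (suc N) f g = trans (+-cong (sumBelow-+ N f g) refl) (+-interchange _ _ _ _)

  sumBelow-*ˡ : ∀ N u f → sumBelow N (λ j → u *R f j) ≈ u *R sumBelow N f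
  sumBelow-*ˡ zero    u f = sym (zeroʳ u)
  sumBelow-*ˡ (suc N) u f = trans (+-cong (sumBelow-*ˡ N u f) refl) (sym (distribˡ u _ _))

  sumBelow-head : ∀ N f → sumBelow (suc N) f ≈ f 0 +R sumBelow N (λ j → f (suc j))
  sumBelow-head zero    f = trans (+-identityˡ (f 0)) (sym (+-identityʳ (f 0)))
  sumBelow-head (suc N) f = trans (+-cong (sumBelow-head N f) refl) (+-assoc _ _ _)

  sumBelow-shift-*ˡ : ∀ N u {f g : ℕ → Carrier} → f 0 ≈ 0# → (∀ j → f (suc j) ≈ u *R g j) →
    sumBelow (suc N) f ≈ u *R sumBelow N g
  sumBelow-shift-*ˡ N u {f} {g} f0≈0 f[1+j]≈ug = begin
    sumBelow (suc N) f                        ≈⟨ sumBelow-head N f ⟩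
    f 0 +R sumBelow N (λ j → f (suc j))       ≈⟨ +-cong f0≈0 (sumBelow-cong N f[1+j]≈ug) ⟩
    0# +R sumBelow N (λ j → u *R g j)         ≈⟨ +-identityˡ _ ⟩
    sumBelow N (λ j → u *R g j)               ≈⟨ sumBelow-*ˡ N u g ⟩
    u *R sumBelow N g                         ∎

  -- hasse i a x N is D⁽ⁱ⁾p(x) for p(t) = Σₖ aₖ tᵏ, truncated to j < N (exact once a vanishes from
  -- index i + N on), and hassePred i a x N is D⁽ⁱ⁻¹⁾p(x), with D⁽⁻¹⁾ = 0.
  hasseTerm : ℕ → (ℕ → ℕ) → Carrier → ℕ → Carrier
  hasseTerm i a x j = (fromℕ ((i + j) C i) *R fromℕ (a (i + j))) *R pow x j

  hasse : ℕ → (ℕ → ℕ) → Carrier → ℕ → Carrier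
  hasse i a x N = sumBelow N (hasseTerm i a x)

  hassePred : ℕ → (ℕ → ℕ) → Carrier → ℕ → Carrier
  hassePred zero    a x N = 0#
  hassePred (suc i) a x N = hasse i a x N

  hasseTerm-vanishes : ∀ i a x j → a (i + j) ≡ 0 → hasseTerm i a x j ≈ 0#
  hasseTerm-vanishes i a x j aᵢ₊ⱼ≡0 rewrite aᵢ₊ⱼ≡0 =
    trans (*-cong (zeroʳ _) refl) (zeroˡ (pow x j))

  hasse-cong : ∀ i {a b} x N → a ≗ b → hasse i a x N ≈ hasse i b x N
  hasse-cong i x N a≗b = sumBelow-cong N λ j → reflexive (≡.cong (λ n → hasseTerm i (λ _ → n) x j) (a≗b (i + j)))

  hasse-truncate : ∀ i a x N → a (i + N) ≡ 0 → hasse i a x (suc N) ≈ hasse i a x N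
  hasse-truncate i a x N aᵢ₊ₙ≡0 = trans (+-cong refl (hasseTerm-vanishes i a x N aᵢ₊ₙ≡0)) (+-identityʳ _)

  hasse-linear : ∀ i n a b x N →
    hasse i (λ k → n * a k + b k) x N ≈ fromℕ n *R hasse i a x N +R hasse i b x N
  hasse-linear i n a b x N = begin
    hasse i (λ k → n * a k + b k) x N
      ≈⟨ sumBelow-cong N (λ j → splitTerm (fromℕ ((i + j) C i)) (a (i + j)) (b (i + j)) (pow x j)) ⟩
    sumBelow N (λ j → fromℕ n *R hasseTerm i a x j +R hasseTerm i b x j)
      ≈⟨ sumBelow-+ N _ _ ⟩
    sumBelow N (λ j → fromℕ n *R hasseTerm i a x j) +R hasse i b x N
      ≈⟨ +-cong (sumBelow-*ˡ N (fromℕ n) _) refl ⟩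
    fromℕ n *R hasse i a x N +R hasse i b x N ∎
    where
    splitTerm : ∀ binom p q z →
      (binom *R fromℕ (n * p + q)) *R z ≈ fromℕ n *R ((binom *R fromℕ p) *R z) +R (binom *R fromℕ q) *R z
    splitTerm binom p q z = begin
      (binom *R fromℕ (n * p + q)) *R z
        ≈⟨ *-cong (*-cong refl (trans (fromℕ-+ (n * p) q) (+-cong (fromℕ-* n p) refl))) refl ⟩
      (binom *R (fromℕ n *R fromℕ p +R fromℕ q)) *R z
        ≈⟨ solve 5 (λ B N P Q Z → (B :* (N :* P :+ Q)) :* Z := N :* ((B :* P) :* Z) :+ (B :* Q) :* Z)
             refl binom (fromℕ n) (fromℕ p) (fromℕ q) z ⟩
      fromℕ n *R ((binom *R fromℕ p) *R z) +R (binom *R fromℕ q) *R z ∎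

  hasse-shiftʳ : ∀ i a x N →
    hasse i (shiftʳ a) x (suc N) ≈ hassePred i a x (suc N) +R x *R hasse i a x N
  hasse-shiftʳ zero a x N = trans
    (sumBelow-shift-*ˡ N x (hasseTerm-vanishes 0 (shiftʳ a) x 0 ≡.refl) λ j → *-leftComm _ x (pow x j))
    (sym (+-identityˡ _))
  hasse-shiftʳ (suc i) a x N = begin
    hasse (suc i) (shiftʳ a) x (suc N)
      ≈⟨ sumBelow-cong (suc N) pascal ⟩
    sumBelow (suc N) (λ j → hasseTerm i a x j +R upper j)
      ≈⟨ sumBelow-+ (suc N) _ upper ⟩
    hasse i a x (suc N) +R sumBelow (suc N) upper
      ≈⟨ +-cong refl (sumBelow-shift-*ˡ N x upper0≈0 upper-suc) ⟩
    hasse i a x (suc N) +R x *R hasse (suc i) a x N ∎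
    where
    upper : ℕ → Carrier
    upper j = (fromℕ ((i + j) C suc i) *R fromℕ (a (i + j))) *R pow x j

    pascal : ∀ j → hasseTerm (suc i) (shiftʳ a) x j ≈ hasseTerm i a x j +R upper j
    pascal j = begin
      (fromℕ (suc (i + j) C suc i) *R fromℕ (a (i + j))) *R pow x j
        ≈⟨ *-cong (*-cong (reflexive (≡.cong fromℕ (≡.sym (nCk+nC[k+1]≡[n+1]C[k+1] (i + j) i)))) refl) refl ⟩
      (fromℕ ((i + j) C i + (i + j) C suc i) *R fromℕ (a (i + j))) *R pow x j
        ≈⟨ *-cong (trans (*-cong (fromℕ-+ ((i + j) C i) ((i + j) C suc i)) refl) (distribʳ _ _ _)) refl ⟩
      ((fromℕ ((i + j) C i) *R fromℕ (a (i + j))) +R (fromℕ ((i + j) C suc i) *R fromℕ (a (i + j)))) *R pow x j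
        ≈⟨ distribʳ _ _ _ ⟩
      hasseTerm i a x j +R upper j ∎

    upper0≈0 : upper 0 ≈ 0#
    upper0≈0 rewrite k>n⇒nCk≡0 {i + 0} {suc i} (ℕ.≤-reflexive (≡.cong suc (ℕ.+-identityʳ i))) =
      trans (*-cong (zeroˡ _) refl) (zeroˡ (pow x 0))

    upper-suc : ∀ j → upper (suc j) ≈ x *R hasseTerm (suc i) a x j
    upper-suc j rewrite ℕ.+-suc i j = *-leftComm _ x (pow x j)

  hasse-recurrence : ∀ i n a b x N → b ≗ (λ k → n * a k + shiftʳ a k) →
    hasse i b x (suc N) ≈ fromℕ n *R hasse i a x (suc N) +R (hassePred i a x (suc N) +R x *R hasse i a x N)
  hasse-recurrence i n a b x N b≗na+ta = begin
    hasse i b x (suc N)                                            ≈⟨ hasse-cong i x (suc N) b≗na+ta ⟩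
    hasse i (λ k → n * a k + shiftʳ a k) x (suc N)                 ≈⟨ hasse-linear i n a (shiftʳ a) x (suc N) ⟩
    fromℕ n *R hasse i a x (suc N) +R hasse i (shiftʳ a) x (suc N) ≈⟨ +-cong refl (hasse-shiftʳ i a x N) ⟩
    fromℕ n *R hasse i a x (suc N) +R (hassePred i a x (suc N) +R x *R hasse i a x N) ∎

  hasse-stirling1-zero : ∀ i x y N → hasse i (stirling1 0) x N ≈ hasse i (stirling1 0) y N
  hasse-stirling1-zero i x y N = sumBelow-cong N (termwise i)
    where
    vanishingTerms-agree : ∀ i j → stirling1 0 (i + j) ≡ 0 →
      hasseTerm i (stirling1 0) x j ≈ hasseTerm i (stirling1 0) y j
    vanishingTerms-agree i j s≡0 =
      trans (hasseTerm-vanishes i (stirling1 0) x j s≡0) (sym (hasseTerm-vanishes i (stirling1 0) y j s≡0))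

    termwise : ∀ i j → hasseTerm i (stirling1 0) x j ≈ hasseTerm i (stirling1 0) y j
    termwise zero    zero    = refl
    termwise zero    (suc j) = vanishingTerms-agree 0 (suc j) ≡.refl
    termwise (suc i) j       = vanishingTerms-agree (suc i) j ≡.refl

  hasse-stirling1-translate : ∀ x m i N → m < i + N →
    hasse i (λ k → stirling1 (suc m) (suc k)) x N ≈ hasse i (stirling1 m) (x +R 1#) N
  hasse-stirling1-translate x zero    i N       _ = hasse-stirling1-zero i x (x +R 1#) N
  hasse-stirling1-translate x (suc m) i zero    _ = refl
  hasse-stirling1-translate x (suc m) i (suc N) m+1<i+[1+N] = begin
    hasse i (P (suc m)) x (suc N)
      ≈⟨ hasse-recurrence i (suc m) (P m) (P (suc m)) x N (stirling1-suc-suc m) ⟩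
    fromℕ (suc m) *R L₁ +R (hassePred i (P m) x (suc N) +R x *R L₀)
      ≈⟨ +-cong refl (+-cong refl (*-cong refl L₀≈L₁)) ⟩
    (1# +R fromℕ m) *R L₁ +R (hassePred i (P m) x (suc N) +R x *R L₁)
      ≈⟨ solve 4 (λ M V Q X → (con 1 :+ M) :* V :+ (Q :+ X :* V) := M :* V :+ (Q :+ (X :+ con 1) :* V))
           refl (fromℕ m) L₁ (hassePred i (P m) x (suc N)) x ⟩
    fromℕ m *R L₁ +R (hassePred i (P m) x (suc N) +R y *R L₁)
      ≈⟨ +-cong (*-cong refl L₁≈R₁) (+-cong (pred-translate i m+1<i+[1+N]) (*-cong refl L₁≈R₀)) ⟩
    fromℕ m *R R₁ +R (hassePred i (stirling1 m) y (suc N) +R y *R R₀)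
      ≈⟨ hasse-recurrence i m (stirling1 m) (stirling1 (suc m)) y N (stirling1-suc m) ⟨
    hasse i (stirling1 (suc m)) y (suc N) ∎
    where
    P : ℕ → ℕ → ℕ
    P n k = stirling1 (suc n) (suc k)
    y L₀ L₁ R₀ R₁ : Carrier
    y  = x +R 1#
    L₀ = hasse i (P m) x N
    L₁ = hasse i (P m) x (suc N)
    R₀ = hasse i (stirling1 m) y N
    R₁ = hasse i (stirling1 m) y (suc N)

    m+1<1+[i+N] : suc m < suc (i + N)
    m+1<1+[i+N] = ≡.subst (suc m <_) (ℕ.+-suc i N) m+1<i+[1+N]

    L₀≈L₁ : L₀ ≈ L₁
    L₀≈L₁ = sym (hasse-truncate i (P m) x N (stirling1-vanishes m+1<1+[i+N]))

    L₁≈R₁ : L₁ ≈ R₁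
    L₁≈R₁ = hasse-stirling1-translate x m i (suc N) (ℕ.<⇒≤ m+1<i+[1+N])

    L₁≈R₀ : L₁ ≈ R₀
    L₁≈R₀ = trans (sym L₀≈L₁) (hasse-stirling1-translate x m i N (s<s⁻¹ m+1<1+[i+N]))

    pred-translate : ∀ i → suc m < i + suc N → hassePred i (P m) x (suc N) ≈ hassePred i (stirling1 m) y (suc N)
    pred-translate zero    _ = refl
    pred-translate (suc i) h = hasse-stirling1-translate x m i (suc N) (s<s⁻¹ h)

mainTheorem2 : {c ℓ : Level} (R : CommutativeRing c ℓ) →
    let open CommutativeRing R renaming (_+_ to _+R_) renaming (_*_ to _*R_) in
    let open RingDefs R in
    (i m : ℕ) → i ≤ m → (x : Carrier) →
    sumBelow (suc (m ∸ i)) (λ j → (fromℕ ((i + j) C i) *R fromℕ (stirling1 (suc m) (suc (i + j)))) *R pow x j)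
      ≈ sumBelow (suc (m ∸ i)) (λ j → (fromℕ ((i + j) C i) *R fromℕ (stirling1 m (i + j))) *R pow (x +R 1#) j)
mainTheorem2 R i m i≤m x = hasse-stirling1-translate R x m i (suc (m ∸ i)) m<i+[1+m∸i]
  where
  m<i+[1+m∸i] : m < i + suc (m ∸ i)
  m<i+[1+m∸i] = ℕ.≤-reflexive (≡.sym (≡.trans (ℕ.+-suc i (m ∸ i)) (≡.cong suc (ℕ.m+[n∸m]≡n i≤m))))
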